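{- Let $M_i=(Q_i,R_i,X_i,\delta_i)$, $i=1,2,3,4$, be rough finite state machines. Then $(M_1\circ M_2)\times(M_3\circ M_4)\preceq(M_1\times M_3)\circ(M_2\times M_4)$.
   Context: For an equivalence relation $R$ on a set $Q$ and $A\subseteq Q$: $\underline{A}=\bigcup\{[q]:[q]\subseteq A\}$, $\overline{A}=\bigcup\{[q]:[q]\cap A\ne\emptyset\}$; a rough set in $(Q,R)$ is a pair $(\underline{A},\overline{A})$ with $A\subseteq Q$. A rough finite state machine (RFSM) is $M=(Q,R,X,\delta)$ with $Q$ nonempty finite, $R$ an equivalence relation on $Q$, $X$ a monoid, and $\delta$ assigning to each $(q,x)\in Q\times X$ a rough set $\delta(q,x)=(\underline{\delta(q,x)},\overline{\delta(q,x)})$ in $(Q,R)$. Covering: for RFSMs $M=(Q,R,X,\delta)$, $M'=(Q',R',X',\delta')$, $M\preceq M'$ means there exist a surjection $\eta:Q'\to Q$ and a monoid homomorphism $\xi:X\to X'$ such that $(p,q)\in R'\Rightarrow(\eta(p),\eta(q))\in R$ for all $p,q\in Q'$, and for all $q\in Q'$, $x\in X$: $\underline{\delta(\eta(q),x)}\subseteq\eta(\underline{\delta'(q,\xi(x))})$ and $\overline{\delta(\eta(q),x)}\subseteq\eta(\overline{\delta'(q,\xi(x))})$. $R\times S$ denotes the equivalence on $Q\times P$ with $((p,p'),(q,q'))\in R\times S$ iff $(p,q)\in R$ and $(p',q')\in S$. Full direct product: $M\times M'=(Q\times Q',R\times R',X\times X',\delta\times\delta')$, product monoid, $(\delta\times\delta')((q,q'),(x,x'))=(\underline{\delta(q,x)}\times\underline{\delta'(q',x')},\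 \overline{\delta(q,x)}\times\overline{\delta'(q',x')})$. Wreath product: $M\circ M'=(Q\times Q',R\times R',X^{Q'}\times X',\delta\circ\delta')$, where $X^{Q'}$ is the set of all maps $Q'\to X$ with pointwise multiplication $(fg)(q')=f(q')g(q')$, $X^{Q'}\times X'$ carries the componentwise monoid structure, and $(\delta\circ\delta')((q,q'),(f,x'))=(\underline{\delta(q,f(q'))}\times\underline{\delta'(q',x')},\ \overline{\delta(q,f(q'))}\times\overline{\delta'(q',x')})$. -}

module Defs where

open import Level using (0ℓ)
open import Data.Nat using (ℕ)
open import Data.Fin using (Fin)
open import Data.Product using (Σ; _×_; _,_; proj₁; proj₂)
open import Function.Bundles using (_↔_; _⇔_; mk⇔; Equivalence)
open import Function.Properties.Inverse using (↔-trans)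
open import Data.Product.Function.NonDependent.Propositional using (_×-↔_)
open import Data.Fin.Properties using (*↔×)
open import Data.Nat using (_*_)
open import Relation.Binary.Core using (Rel)
open import Relation.Binary.Structures using (IsEquivalence)
open import Relation.Binary.PropositionalEquality using (_≡_)
open import Algebra.Bundles using (Monoid)
open import Algebra.Morphism.Structures using (IsMonoidHomomorphism)
import Algebra.Construct.DirectProduct as DP
import Algebra.Construct.Pointwise as PW

Subset : Set → Set₁
Subset Q = Q → Set

_⊆_ : {Q : Set} → Subset Q → Subset Q → Set
A ⊆ B = ∀ q → A q → B q

_≐_ : {Q : Set} → Subset Q → Subset Q → Set
A ≐ B = ∀ q → A q ⇔ B q

image : {P Q : Set} → (P → Q) → Subset P → Subset Q
image {P} η S q = Σ P λ p → S p × η p ≡ q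

class : {Q : Set} → Rel Q 0ℓ → Q → Subset Q
class R q p = R q p

lowerApprox : {Q : Set} → Rel Q 0ℓ → Subset Q → Subset Q
lowerApprox {Q} R A x = Σ Q λ q → class R q x × (class R q ⊆ A)

upperApprox : {Q : Set} → Rel Q 0ℓ → Subset Q → Subset Q
upperApprox {Q} R A x = Σ Q λ q → class R q x × (Σ Q λ p → class R q p × A p)

record RoughSet (Q : Set) (R : Rel Q 0ℓ) : Set₁ where
  field
    lower    : Subset Q
    upper    : Subset Q
    base     : Subset Q
    lower-eq : lower ≐ lowerApprox R base
    upper-eq : upper ≐ upperApprox R base

record RFSM : Set₁ where
  field
    Q        : Set
    finite   : Σ ℕ λ n → Q ↔ Fin n
    nonempty : Q
    R        : Rel Q 0ℓ
    R-equiv  : IsEquivalence R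
    X        : Monoid 0ℓ 0ℓ
    δ        : Q → Monoid.Carrier X → RoughSet Q R

open RoughSet public

record _≼_ (M M' : RFSM) : Set₁ where
  private
    module M  = RFSM M
    module M' = RFSM M'
  field
    η      : M'.Q → M.Q
    η-surj : ∀ q → Σ M'.Q λ p → η p ≡ q
    ξ      : Monoid.Carrier M.X → Monoid.Carrier M'.X
    ξ-hom  : IsMonoidHomomorphism (Monoid.rawMonoid M.X) (Monoid.rawMonoid M'.X) ξ
    η-R    : ∀ p q → M'.R p q → M.R (η p) (η q)
    lower-cover : ∀ q x → lower (M.δ (η q) x) ⊆ image η (lower (M'.δ q (ξ x)))
    upper-cover : ∀ q x → upper (M.δ (η q) x) ⊆ image η (upper (M'.δ q (ξ x)))

_×ᴿ_ : {Q P : Set} → Rel Q 0ℓ → Rel P 0ℓ → Rel (Q × P) 0ℓ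
(R ×ᴿ S) (p , p') (q , q') = R p q × S p' q'

_×ˢ_ : {Q P : Set} → Subset Q → Subset P → Subset (Q × P)
(A ×ˢ B) (q , p) = A q × B p

×ᴿ-isEquivalence : {Q P : Set} {R : Rel Q 0ℓ} {S : Rel P 0ℓ} →
  IsEquivalence R → IsEquivalence S → IsEquivalence (R ×ᴿ S)
×ᴿ-isEquivalence eR eS = record
  { refl  = IsEquivalence.refl eR , IsEquivalence.refl eS
  ; sym   = λ { (r , s) → IsEquivalence.sym eR r , IsEquivalence.sym eS s }
  ; trans = λ { (r , s) (r' , s') → IsEquivalence.trans eR r r' , IsEquivalence.trans eS s s' }
  }

×-finite : {Q P : Set} → (Σ ℕ λ n → Q ↔ Fin n) → (Σ ℕ λ m → P ↔ Fin m) →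
  Σ ℕ λ k → (Q × P) ↔ Fin k
×-finite (n , f) (m , g) = n * m , ↔-trans (f ×-↔ g) (Inverse-sym *↔×)
  where open import Function.Properties.Inverse using () renaming (↔-sym to Inverse-sym)

roughProd : {Q P : Set} {R : Rel Q 0ℓ} {S : Rel P 0ℓ} →
  IsEquivalence R → IsEquivalence S →
  RoughSet Q R → RoughSet P S → RoughSet (Q × P) (R ×ᴿ S)
roughProd {R = R} {S = S} eR eS a b = record
  { lower    = lower a ×ˢ lower b
  ; upper    = upper a ×ˢ upper b
  ; base     = base a ×ˢ base b
  ; lower-eq = λ { (x , y) → mk⇔ (lo→ x y) (lo← x y) }
  ; upper-eq = λ { (x , y) → mk⇔ (up→ x y) (up← x y) }
  }
  where
  lo→ : ∀ x y → (lower a ×ˢ lower b) (x , y) → lowerApprox (R ×ᴿ S) (base a ×ˢ base b) (x , y)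
  lo→ x y (la , lb) with Equivalence.to (lower-eq a x) la | Equivalence.to (lower-eq b y) lb
  ... | (q , Rqx , hA) | (q' , Sq'y , hB) =
    (q , q') , (Rqx , Sq'y) , λ { (p , p') (r , s) → hA p r , hB p' s }
  lo← : ∀ x y → lowerApprox (R ×ᴿ S) (base a ×ˢ base b) (x , y) → (lower a ×ˢ lower b) (x , y)
  lo← x y ((q , q') , (Rqx , Sq'y) , h) =
      Equivalence.from (lower-eq a x) (q , Rqx , λ p r → proj₁ (h (p , q') (r , IsEquivalence.refl eS)))
    , Equivalence.from (lower-eq b y) (q' , Sq'y , λ p' s → proj₂ (h (q , p') (IsEquivalence.refl eR , s)))
  up→ : ∀ x y → (upper a ×ˢ upper b) (x , y) → upperApprox (R ×ᴿ S) (base a ×ˢ base b) (x , y)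
  up→ x y (ua , ub) with Equivalence.to (upper-eq a x) ua | Equivalence.to (upper-eq b y) ub
  ... | (q , Rqx , p , Rqp , Ap) | (q' , Sq'y , p' , Sq'p' , Bp') =
    (q , q') , (Rqx , Sq'y) , (p , p') , (Rqp , Sq'p') , (Ap , Bp')
  up← : ∀ x y → upperApprox (R ×ᴿ S) (base a ×ˢ base b) (x , y) → (upper a ×ˢ upper b) (x , y)
  up← x y ((q , q') , (Rqx , Sq'y) , (p , p') , (Rqp , Sq'p') , (Ap , Bp')) =
      Equivalence.from (upper-eq a x) (q , Rqx , p , Rqp , Ap)
    , Equivalence.from (upper-eq b y) (q' , Sq'y , p' , Sq'p' , Bp')

_⊗_ : RFSM → RFSM → RFSM
M ⊗ M' = record
  { Q        = M.Q × M'.Q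
  ; finite   = ×-finite M.finite M'.finite
  ; nonempty = M.nonempty , M'.nonempty
  ; R        = M.R ×ᴿ M'.R
  ; R-equiv  = ×ᴿ-isEquivalence M.R-equiv M'.R-equiv
  ; X        = DP.monoid M.X M'.X
  ; δ        = λ { (q , q') (x , x') → roughProd M.R-equiv M'.R-equiv (M.δ q x) (M'.δ q' x') }
  }
  where
  module M  = RFSM M
  module M' = RFSM M'

_≀_ : RFSM → RFSM → RFSM
M ≀ M' = record
  { Q        = M.Q × M'.Q
  ; finite   = ×-finite M.finite M'.finite
  ; nonempty = M.nonempty , M'.nonempty
  ; R        = M.R ×ᴿ M'.R
  ; R-equiv  = ×ᴿ-isEquivalence M.R-equiv M'.R-equiv
  ; X        = DP.monoid (PW.monoid M'.Q M.X) M'.X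
  ; δ        = λ { (q , q') (f , x') → roughProd M.R-equiv M'.R-equiv (M.δ q (f q')) (M'.δ q' x') }
  }
  where
  module M  = RFSM M
  module M' = RFSM M'

module Submission where

open import Defs
open import Level using (0ℓ)
open import Data.Product using (_×_; _,_)
open import Relation.Binary.PropositionalEquality using (_≡_; refl)
open import Algebra.Bundles using (Monoid)
open import Algebra.Morphism.Structures using (IsMonoidHomomorphism)
import Algebra.Construct.DirectProduct as DP
import Algebra.Construct.Pointwise as PW

-- Both machines have the states of M₁, …, M₄ as components, only with the middle two
-- factors swapped, and both transition functions are fourfold products of δ₁, …, δ₄ on
-- matching inputs once (f , g) ∈ X₁^Q₂ × X₃^Q₄ is read as (q₂ , q₄) ↦ (f q₂ , g q₄).
-- So the middle-four interchange covers, with the interchanged state as every witness.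

interchange : {A B C D : Set} → (A × B) × (C × D) → (A × C) × (B × D)
interchange ((a , b) , (c , d)) = (a , c) , (b , d)

interchange-involutive : {A B C D : Set} (y : (A × B) × (C × D)) →
  interchange (interchange y) ≡ y
interchange-involutive ((a , b) , (c , d)) = refl

interchange-×ˢ : {A B C D : Set}
  {S₁ : Subset A} {S₂ : Subset B} {S₃ : Subset C} {S₄ : Subset D} →
  ((S₁ ×ˢ S₂) ×ˢ (S₃ ×ˢ S₄)) ⊆ image interchange ((S₁ ×ˢ S₃) ×ˢ (S₂ ×ˢ S₄))
interchange-×ˢ y s = interchange y , interchange s , interchange-involutive y

module _ (A B : Set) (K L M N : Monoid 0ℓ 0ℓ) where
  private
    module K = Monoid K
    module L = Monoid L
    module M = Monoid M
    module N = Monoid N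

  pairMaps : (A → K.Carrier) × (B → M.Carrier) → (A × B → K.Carrier × M.Carrier)
  pairMaps (f , g) (a , b) = f a , g b

  pairWreathInputs :
    ((A → K.Carrier) × L.Carrier) × ((B → M.Carrier) × N.Carrier) →
    (A × B → K.Carrier × M.Carrier) × (L.Carrier × N.Carrier)
  pairWreathInputs ((f , x) , (g , y)) = pairMaps (f , g) , (x , y)

  pairWreathInputs-isMonoidHomomorphism :
    IsMonoidHomomorphism
      (Monoid.rawMonoid (DP.monoid (DP.monoid (PW.monoid A K) L) (DP.monoid (PW.monoid B M) N)))
      (Monoid.rawMonoid (DP.monoid (PW.monoid (A × B) (DP.monoid K M)) (DP.monoid L N)))
      pairWreathInputs
  pairWreathInputs-isMonoidHomomorphism = record
    { isMagmaHomomorphism = record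
      { isRelHomomorphism = record
        { cong = λ { ((f≈ , x≈) , (g≈ , y≈)) → (λ { (a , b) → f≈ a , g≈ b }) , (x≈ , y≈) } }
      ; homo = λ _ _ → (λ _ → K.refl , M.refl) , (L.refl , N.refl)
      }
    ; ε-homo = (λ _ → K.refl , M.refl) , (L.refl , N.refl)
    }

proposition3p2 : (M₁ M₂ M₃ M₄ : RFSM) →
    ((M₁ ≀ M₂) ⊗ (M₃ ≀ M₄)) ≼ ((M₁ ⊗ M₃) ≀ (M₂ ⊗ M₄))
proposition3p2 M₁ M₂ M₃ M₄ = record
  { η           = interchange
  ; η-surj      = λ q → interchange q , interchange-involutive q
  ; ξ           = pairWreathInputs Q₂ Q₄ X₁ X₂ X₃ X₄
  ; ξ-hom       = pairWreathInputs-isMonoidHomomorphism Q₂ Q₄ X₁ X₂ X₃ X₄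
  ; η-R         = λ _ _ → interchange
  ; lower-cover = λ _ _ → interchange-×ˢ
  ; upper-cover = λ _ _ → interchange-×ˢ
  }
  where
  open RFSM M₁ using () renaming (X to X₁)
  open RFSM M₂ using () renaming (Q to Q₂; X to X₂)
  open RFSM M₃ using () renaming (X to X₃)
  open RFSM M₄ using () renaming (Q to Q₄; X to X₄)
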